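{- Let $\beta>1$ be a Parry number and $L$ the language of $U_\beta$ (as in the context). If $(u,v)\in L\times L$ satisfies condition $(\star)$, then $\binom{u}{v}\equiv1\pmod 2$.
   Context: For finite words $u,v$, $\binom{u}{v}$ is the number of occurrences of $v$ as a (scattered) subsequence of $u$; $\varepsilon$ is the empty word; $|w|$ the length. For a set of words $K$, $u^{ -1}.K=\{w:uw\in K\}$. Let $\beta>1$ be real and $A_\beta=\{0,1,\ldots,\lceil\beta\rceil-1\}$. Every $x\in[0,1)$ has a greedy $\beta$-expansion $d_\beta(x)=c_1c_2\cdots$ over $A_\beta$ with $x=\sum_{j\ge1}c_j\beta^{ -j}$ and $\sum_{i\ge j}c_i\beta^{ -i}<\beta^{ -j+1}$ for all $j\ge1$. The $\beta$-expansion of $1$ is $d_\beta(1)=(\beta-1)^\omega$ if $\beta\in\mathbb{N}$, and otherwise $d_\beta(1)=(\lceil\beta\rceil-1)\,d_\beta\big(1-(\lceil\beta\rceil-1)/\beta\big)$. $\beta$ is a Parry number if $d_\beta(1)$ is ultimately periodic. Define $U_\beta=(U_\beta(n))_{n\ge0}$: if $d_\beta(1)=t_1\cdots t_m0^\omega$ ($t_m\ne0$), set $U_\beta(0)=1$, $U_\beta(i)=t_1U_\beta(i-1)+\cdots+t_iU_\beta(0)+1$ for $1\le i\le m-1$, and $U_\beta(n)=t_1U_\beta(n-1)+\cdots+t_mU_\beta(n-m)$ for $n\ge m$; if $d_\beta(1)=t_1\cdots t_m(t_{m+1}\cdots t_{m+k})^\omega$ with $m,k$ minimal (and not of the previous form),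 set $U_\beta(0)=1$, $U_\beta(i)=t_1U_\beta(i-1)+\cdots+t_iU_\beta(0)+1$ for $1\le i\le m+k-1$, and for $n\ge m+k$, $U_\beta(n)=t_1U_\beta(n-1)+\cdots+t_{m+k}U_\beta(n-m-k)+U_\beta(n-k)-t_1U_\beta(n-k-1)-\cdots-t_mU_\beta(n-m-k)$. For $n\ge1$, $\mathrm{rep}_{U_\beta}(n)$ is the greedy representation $c_{\ell-1}\cdots c_0$ with $n=\sum_jc_jU_\beta(j)$, $c_{\ell-1}\ne0$, and $\mathrm{rep}_{U_\beta}(0)=\varepsilon$. $L=\mathrm{rep}_{U_\beta}(\mathbb{N})$. For non-empty $u,v\in L$, $p(u,v)$ is the smallest non-negative integer $p$ with $(u0^p)^{ -1}.L=(v0^p)^{ -1}.L=0^*L$ (it exists); $p(\varepsilon,\varepsilon)=0$. A pair $(u,v)\in L\times L$ satisfies $(\star)$ if either $u=v=\varepsilon$, or $|u|\ge|v|>0$ and, with $p=p(u,v)$, $\binom{u0^p}{v0^p}\equiv1\pmod2$ and $\binom{u0^p}{v0^pa}=0$ for all $a\in A_\beta$. -}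

module Defs where

open import Data.Nat using (ℕ; zero; suc; _+_; _*_; _∸_; _≤_; _<_; _<ᵇ_; _≤ᵇ_; _≡ᵇ_; pred)
open import Data.Nat.DivMod using (_/_; _%_)
open import Data.Bool using (Bool; true; false; if_then_else_)
open import Data.List using (List; []; _∷_; _++_; replicate; drop; length)
open import Data.Product using (Σ; ∃; ∃-syntax; _×_; _,_)
open import Data.Sum using (_⊎_)
open import Relation.Nullary using (¬_)
open import Relation.Binary.PropositionalEquality using (_≡_; _≢_)

Word : Set
Word = List ℕ

-- Number of occurrences of v as a scattered subsequence of u: binom u v.
binom : Word → Word → ℕ
binom u [] = 1
binom [] (b ∷ v) = 0
binom (a ∷ u) (b ∷ v) = (if a ≡ᵇ b then binom u v else 0) + binom u (b ∷ v)

-- The expansion d_β(1) = t₁ t₂ t₃ … is a sequence s : ℕ → ℕ with s i = t_{i+1}.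

LexLt : (ℕ → ℕ) → (ℕ → ℕ) → Set
LexLt x y = ∃[ j ] ((∀ i → i < j → x i ≡ y i) × x j < y j)

-- s is d_β(1) for some real β > 1 (with the convention of the context:
-- (β-1)^ω for integer β, the greedy expansion otherwise).  Stated through
-- Parry's characterisation.
IsDBeta1 : (ℕ → ℕ) → Set
IsDBeta1 s =
  (∃[ b ] (2 ≤ b × (∀ i → s i ≡ b ∸ 1)))
  ⊎ (1 ≤ s 0
     × (∀ n → LexLt (λ i → s (suc n + i)) s)
     × ¬ (∀ i → 1 ≤ i → s i ≡ 0))

-- shape of an ultimately periodic d_β(1)
data Kind : Set where
  fin : ℕ → Kind          -- t₁ ⋯ t_m 0^ω, t_m ≠ 0
  per : ℕ → ℕ → Kind      -- t₁ ⋯ t_m (t_{m+1} ⋯ t_{m+k})^ω, m,k minimal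

PerAt : (ℕ → ℕ) → ℕ → ℕ → Set
PerAt s m k = ∀ i → m ≤ i → s (i + k) ≡ s i

EventuallyZero : (ℕ → ℕ) → Set
EventuallyZero s = ∃[ m ] (∀ i → m ≤ i → s i ≡ 0)

ShapeOf : (ℕ → ℕ) → Kind → Set
ShapeOf s (fin m) = 1 ≤ m × s (pred m) ≢ 0 × (∀ i → m ≤ i → s i ≡ 0)
ShapeOf s (per m k) =
  1 ≤ k × PerAt s m k
  × (∀ m' k' → 1 ≤ k' → PerAt s m' k' → m ≤ m' × k ≤ k')
  × ¬ EventuallyZero s

wsum : (ℕ → ℕ) → ℕ → List ℕ → ℕ
wsum f zero xs = 0
wsum f (suc b) [] = 0
wsum f (suc b) (x ∷ xs) = f 0 * x + wsum (λ j → f (suc j)) b xs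

nth : ℕ → List ℕ → ℕ
nth n [] = 0
nth zero (x ∷ xs) = x
nth (suc n) (x ∷ xs) = nth n xs

-- nextU s κ n prev computes U(n) from prev = [U(n-1), …, U(0)]
nextU : (ℕ → ℕ) → Kind → ℕ → List ℕ → ℕ
nextU s (fin m) n prev =
  if n <ᵇ m then wsum s n prev + 1 else wsum s m prev
nextU s (per m k) n prev =
  if n <ᵇ m + k then wsum s n prev + 1
  else (wsum s (m + k) prev + nth (k ∸ 1) prev) ∸ wsum s m (drop k prev)

hist : (ℕ → ℕ) → Kind → ℕ → List ℕ
hist s κ zero = []
hist s κ (suc n) = nextU s κ n (hist s κ n) ∷ hist s κ n

U : (ℕ → ℕ) → Kind → ℕ → ℕ
U s κ n = nextU s κ n (hist s κ n)

-- division with the convention a / 0 = 0 (never used: U(j) ≥ 1)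
divN : ℕ → ℕ → ℕ
divN a zero = 0
divN a (suc b) = a / suc b

modN : ℕ → ℕ → ℕ
modN a zero = a
modN a (suc b) = a % suc b

topIdx : (ℕ → ℕ) → ℕ → ℕ → ℕ
topIdx V n zero = 0
topIdx V n (suc j) = if V (suc j) ≤ᵇ n then suc j else topIdx V n j

digits : (ℕ → ℕ) → ℕ → ℕ → Word
digits V zero r = divN r (V 0) ∷ []
digits V (suc j) r = divN r (V (suc j)) ∷ digits V j (modN r (V (suc j)))

-- rep_U(n): greedy representation, most significant digit first
-- (the largest j with U(j) ≤ n satisfies j < n since U is increasing)
rep : (ℕ → ℕ) → Kind → ℕ → Word
rep s κ zero = []
rep s κ (suc n) = digits (U s κ) (topIdx (U s κ) (suc n) (suc n)) (suc n)

InL : (ℕ → ℕ) → Kind → Word → Set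
InL s κ w = ∃[ n ] (rep s κ n ≡ w)

zeros : ℕ → Word
zeros p = replicate p 0

QuotIs0L : (ℕ → ℕ) → Kind → Word → Set
QuotIs0L s κ x =
  ∀ w → ((InL s κ (x ++ w) → ∃[ i ] ∃[ y ] (InL s κ y × w ≡ zeros i ++ y))
        × (∃[ i ] ∃[ y ] (InL s κ y × w ≡ zeros i ++ y) → InL s κ (x ++ w)))

IsP : (ℕ → ℕ) → Kind → Word → Word → ℕ → Set
IsP s κ u v p =
  QuotIs0L s κ (u ++ zeros p) × QuotIs0L s κ (v ++ zeros p)
  × (∀ q → q < p → ¬ (QuotIs0L s κ (u ++ zeros q) × QuotIs0L s κ (v ++ zeros q)))

-- condition (⋆); the alphabet A_β = {0, …, ⌈β⌉-1} = {0, …, t₁}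
Star : (ℕ → ℕ) → Kind → Word → Word → Set
Star s κ u v =
  (u ≡ [] × v ≡ [])
  ⊎ (length v ≤ length u × 0 < length v
     × ∃[ p ] (IsP s κ u v p
               × binom (u ++ zeros p) (v ++ zeros p) % 2 ≡ 1
               × (∀ a → a ≤ s 0 → binom (u ++ zeros p) (v ++ zeros p ++ a ∷ []) ≡ 0)))

{-# OPTIONS --safe #-}
-- Appending a common letter gives binom (x a) (y a) = binom x y + binom x (y a), so
-- binom (x a) (y a) = 0 forces binom x y = 0. Hence if v 0^p 0 does not occur in u 0^p,
-- neither does v 0^i 0 in u 0^i for any i ≤ p, and peeling the zeros off one at a time
-- shows binom (u 0^p) (v 0^p) = binom u v. Nothing about β, L or the minimality of p is used.
module Submission where

open import Defs
open import Data.Nat using (ℕ; zero; suc; _%_; _+_; _≡ᵇ_; z≤n)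
open import Data.Nat.Properties using (+-identityʳ; m+n≡0⇒m≡0; +-commutativeSemigroup; ≡⇒≡ᵇ)
open import Data.Bool using (Bool; true; false; if_then_else_)
open import Data.Bool.Properties using (if-eta; if-swap-then; T-≡)
open import Data.List using (List; []; _∷_; _++_; _∷ʳ_; [_]; replicate)
open import Data.List.Properties using (++-assoc; ++-identityʳ)
open import Data.Product using (_,_)
open import Data.Sum using (inj₁; inj₂)
open import Function.Bundles using (Equivalence)
open import Algebra.Properties.CommutativeSemigroup +-commutativeSemigroup using (interchange; x∙yz≈y∙xz)
open import Relation.Binary.PropositionalEquality using (_≡_; refl; sym; trans; cong; cong₂; subst; subst₂; module ≡-Reasoning)
open ≡-Reasoning

infixr 7 [_]·_
[_]·_ : Bool → ℕ → ℕ
[ b ]· n = if b then n else 0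

[]·-distrib-+ : ∀ b m n → [ b ]· (m + n) ≡ [ b ]· m + [ b ]· n
[]·-distrib-+ true  m n = refl
[]·-distrib-+ false m n = refl

replicate-suc : ∀ {A : Set} n (a : A) → replicate (suc n) a ≡ replicate n a ∷ʳ a
replicate-suc zero    a = refl
replicate-suc (suc n) a = cong (a ∷_) (replicate-suc n a)

++-replicate-suc : ∀ {A : Set} (xs : List A) n a →
                   xs ++ replicate (suc n) a ≡ (xs ++ replicate n a) ∷ʳ a
++-replicate-suc xs n a = begin
  xs ++ replicate (suc n) a   ≡⟨ cong (xs ++_) (replicate-suc n a) ⟩
  xs ++ (replicate n a ∷ʳ a)  ≡⟨ ++-assoc xs (replicate n a) [ a ] ⟨
  (xs ++ replicate n a) ∷ʳ a  ∎

binom-[]-∷ʳ : ∀ w b → binom [] (w ∷ʳ b) ≡ 0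
binom-[]-∷ʳ []      b = refl
binom-[]-∷ʳ (_ ∷ _) b = refl

binom-∷ʳ : ∀ x y a b → binom (x ∷ʳ a) (y ∷ʳ b) ≡ [ a ≡ᵇ b ]· binom x y + binom x (y ∷ʳ b)
binom-∷ʳ []      []      a b = refl
binom-∷ʳ []      (c ∷ y) a b
  rewrite binom-[]-∷ʳ y b | if-eta (a ≡ᵇ c) {0} | if-eta (a ≡ᵇ b) {0} = refl
binom-∷ʳ (c ∷ x) []      a b = begin
  [ C ]· 1 + binom (x ∷ʳ a) [ b ]       ≡⟨ cong ([ C ]· 1 +_) (binom-∷ʳ x [] a b) ⟩
  [ C ]· 1 + ([ A ]· 1 + binom x [ b ]) ≡⟨ x∙yz≈y∙xz ([ C ]· 1) ([ A ]· 1) (binom x [ b ]) ⟩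
  [ A ]· 1 + ([ C ]· 1 + binom x [ b ]) ∎
  where
  A C : Bool
  A = a ≡ᵇ b
  C = c ≡ᵇ b
binom-∷ʳ (c ∷ x) (d ∷ y) a b = begin
  [ C ]· binom (x ∷ʳ a) (y ∷ʳ b) + binom (x ∷ʳ a) (d ∷ y ∷ʳ b)
    ≡⟨ cong₂ (λ m n → [ C ]· m + n) (binom-∷ʳ x y a b) (binom-∷ʳ x (d ∷ y) a b) ⟩
  [ C ]· ([ A ]· xy + xyb) + ([ A ]· xdy + xdyb)
    ≡⟨ cong (_+ ([ A ]· xdy + xdyb)) ([]·-distrib-+ C ([ A ]· xy) xyb) ⟩
  ([ C ]· [ A ]· xy + [ C ]· xyb) + ([ A ]· xdy + xdyb)
    ≡⟨ interchange ([ C ]· [ A ]· xy) ([ C ]· xyb) ([ A ]· xdy) xdyb ⟩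
  ([ C ]· [ A ]· xy + [ A ]· xdy) + ([ C ]· xyb + xdyb)
    ≡⟨ cong (λ n → (n + [ A ]· xdy) + ([ C ]· xyb + xdyb)) (if-swap-then C A) ⟩
  ([ A ]· [ C ]· xy + [ A ]· xdy) + ([ C ]· xyb + xdyb)
    ≡⟨ cong (_+ ([ C ]· xyb + xdyb)) ([]·-distrib-+ A ([ C ]· xy) xdy) ⟨
  [ A ]· ([ C ]· xy + xdy) + ([ C ]· xyb + xdyb)
    ∎
  where
  A C : Bool
  A = a ≡ᵇ b
  C = c ≡ᵇ d
  xy xyb xdy xdyb : ℕ
  xy = binom x y
  xyb = binom x (y ∷ʳ b)
  xdy = binom x (d ∷ y)
  xdyb = binom x (d ∷ y ∷ʳ b)

binom-∷ʳ-same : ∀ x y a → binom (x ∷ʳ a) (y ∷ʳ a) ≡ binom x y + binom x (y ∷ʳ a)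
binom-∷ʳ-same x y a = begin
  binom (x ∷ʳ a) (y ∷ʳ a)                  ≡⟨ binom-∷ʳ x y a a ⟩
  [ a ≡ᵇ a ]· binom x y + binom x (y ∷ʳ a) ≡⟨ cong (λ b → [ b ]· binom x y + binom x (y ∷ʳ a)) a≡ᵇa ⟩
  binom x y + binom x (y ∷ʳ a)             ∎
  where
  a≡ᵇa : (a ≡ᵇ a) ≡ true
  a≡ᵇa = Equivalence.to T-≡ (≡⇒≡ᵇ a a refl)

binom-∷ʳ≡0⇒binom≡0 : ∀ x y a → binom (x ∷ʳ a) (y ∷ʳ a) ≡ 0 → binom x y ≡ 0
binom-∷ʳ≡0⇒binom≡0 x y a h = m+n≡0⇒m≡0 (binom x y) (trans (sym (binom-∷ʳ-same x y a)) h)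

binom-∷ʳ-cancel : ∀ x y a → binom x (y ∷ʳ a) ≡ 0 → binom (x ∷ʳ a) (y ∷ʳ a) ≡ binom x y
binom-∷ʳ-cancel x y a h = begin
  binom (x ∷ʳ a) (y ∷ʳ a)       ≡⟨ binom-∷ʳ-same x y a ⟩
  binom x y + binom x (y ∷ʳ a)  ≡⟨ cong (binom x y +_) h ⟩
  binom x y + 0                 ≡⟨ +-identityʳ (binom x y) ⟩
  binom x y                     ∎

binom-++-replicate-cancel : ∀ p x y a → binom (x ++ replicate p a) (y ++ replicate (suc p) a) ≡ 0 →
                            binom (x ++ replicate p a) (y ++ replicate p a) ≡ binom x y
binom-++-replicate-cancel zero    x y a _ = cong₂ binom (++-identityʳ x) (++-identityʳ y)
binom-++-replicate-cancel (suc p) x y a h = begin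
  binom (x ++ replicate (suc p) a) (y ++ replicate (suc p) a)
    ≡⟨ cong₂ binom (++-replicate-suc x p a) (++-replicate-suc y p a) ⟩
  binom (X ∷ʳ a) (Y ∷ʳ a)
    ≡⟨ binom-∷ʳ-cancel X Y a (subst (λ w → binom X w ≡ 0) (++-replicate-suc y p a) X∌Ya) ⟩
  binom X Y
    ≡⟨ binom-++-replicate-cancel p x y a X∌Ya ⟩
  binom x y ∎
  where
  X Y : Word
  X = x ++ replicate p a
  Y = y ++ replicate p a
  X∌Ya : binom X (y ++ replicate (suc p) a) ≡ 0
  X∌Ya = binom-∷ʳ≡0⇒binom≡0 X (y ++ replicate (suc p) a) a
           (subst₂ (λ w z → binom w z ≡ 0) (++-replicate-suc x p a) (++-replicate-suc y (suc p) a) h)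

proposition26 : (s : ℕ → ℕ) (κ : Kind) → IsDBeta1 s → ShapeOf s κ →
    (u v : Word) → InL s κ u → InL s κ v → Star s κ u v →
    binom u v % 2 ≡ 1
proposition26 s κ _ _ .[] .[] _ _ (inj₁ (refl , refl)) = refl
proposition26 s κ _ _ u v _ _ (inj₂ (_ , _ , p , _ , odd , unextendable)) =
  subst (λ n → n % 2 ≡ 1) (binom-++-replicate-cancel p u v 0 u0ᵖ∌v0ᵖ⁺¹) odd
  where
  u0ᵖ∌v0ᵖ⁺¹ : binom (u ++ zeros p) (v ++ zeros (suc p)) ≡ 0
  u0ᵖ∌v0ᵖ⁺¹ = subst (λ w → binom (u ++ zeros p) (v ++ w) ≡ 0) (sym (replicate-suc p 0)) (unextendable 0 z≤n)
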